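{- Let $\mathbb N$ be an infinite set and $\Sigma_0=\Sigma(\mathbb N,\mathfrak G^{\mathbb N}_1,\mathcal I_0^{\mathbb N})$ the basic Fraenkel model of second order. For any $n,m\ge1$ and any second-order formula $H(\mathbf x,D)$, where $\mathbf x=(x_1,\dots,x_n)$ are distinct individual variables and $D$ is an $m$-ary predicate variable ($H$ possibly containing further free variables), \[\Sigma_0\models choice_h^{n,m}(H).\]
   Context: Metatheory is ZFC (assumed consistent). For a nonempty set $I$, ${\rm pred}_k(I)$ is the set of maps $\alpha:I^k\to\{true,false\}$, with extension $\widetilde\alpha$. A predicate structure is $(J_k)_{k\ge0}$ with $J_0=I$, $\emptyset\ne J_k\subseteq{\rm pred}_k(I)$; assignments send individual variables into $J_0$ and $k$-ary predicate variables into $J_k$, and $k$-ary predicate quantifiers range over $J_k$ (Henkin semantics); $\Sigma\models F$ means $F$ is true under every assignment. $\mathfrak G^I_1$ is the group of all permutations of $I$; for a permutation $\pi$, $\alpha^\pi$ has extension $\{(\pi(\xi_1),\dots,\pi(\xi_k)):\xi\in\widetilde\alpha\}$; for a subgroup $\mathfrak G$ and $P\subseteq I$, $\mathfrak G(P)=\{\pi\in\mathfrak G:\pi(p)=p\ \forall p\in P\}$ and ${\rm sym}_{\mathfrak G}(\alpha)=\{\pi\in\mathfrak G:\alpha^\pi=\alpha\}$. $\Sigma(I,\mathfrak G,\mathcal I_0^I)$ has $J_0=I$ and $J_k=\{\alpha\in{\rm pred}_k(I):\text{there is a finite }P\subseteq I\text{ with }\mathfrak G(P)\subseteq{\rm sym}_{\mathfrak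 G}(\alpha)\}$ for $k\ge1$. The Ackermann axiom $choice_h^{n,m}(H)$ is the formula $\forall\mathbf x\exists D\,H(\mathbf x,D)\to\exists S\forall\mathbf x\exists D\big(\forall\mathbf y(D\mathbf y\leftrightarrow S\mathbf x\mathbf y)\land H(\mathbf x,D)\big)$, where $\mathbf y$ is an $m$-tuple of distinct individual variables and $S$ an $(n+m)$-ary predicate variable, neither occurring in $H$, and $S\mathbf x\mathbf y$ is $S$ applied to the concatenation of $\mathbf x$ and $\mathbf y$. -}

module Defs where

open import Level using (0ℓ)
open import Data.Nat using (ℕ; zero; suc; _+_; _≟_)
open import Data.Fin using (Fin)
open import Data.Vec using (Vec; []; _∷_; map; lookup; _++_; foldr)
open import Data.Bool using (Bool; true; false)
open import Data.Product using (Σ; _×_; _,_; proj₁; proj₂)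
open import Data.Sum using (_⊎_)
open import Data.List using (List; []; _∷_) renaming (_++_ to _++ₗ_)
open import Data.List.Membership.Propositional using (_∈_; _∉_)
open import Relation.Nullary using (¬_; yes; no)
open import Relation.Binary.PropositionalEquality using (_≡_; _≢_; refl)
open import Function.Bundles using (_↔_; Inverse)

-- A predicate variable is a pair
-- (k , X) with name X : ℕ and arity (suc k) (predicate variables have
-- arity ≥ 1; 0-ary "predicates" are the individuals, J₀ = I).

data Formula : Set where
  _≐_  : ℕ → ℕ → Formula
  app  : (k X : ℕ) → Vec ℕ (suc k) → Formula
  neg  : Formula → Formula
  and  : Formula → Formula → Formula
  or   : Formula → Formula → Formula
  imp  : Formula → Formula → Formula
  iff  : Formula → Formula → Formula
  ∀ᵢ   : ℕ → Formula → Formula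
  ∃ᵢ   : ℕ → Formula → Formula
  ∀ₚ   : (k X : ℕ) → Formula → Formula
  ∃ₚ   : (k X : ℕ) → Formula → Formula

indVars : Formula → List ℕ
indVars (x ≐ y) = x ∷ y ∷ []
indVars (app k X xs) = Data.Vec.toList xs
indVars (neg F) = indVars F
indVars (and F G) = indVars F ++ₗ indVars G
indVars (or F G) = indVars F ++ₗ indVars G
indVars (imp F G) = indVars F ++ₗ indVars G
indVars (iff F G) = indVars F ++ₗ indVars G
indVars (∀ᵢ x F) = x ∷ indVars F
indVars (∃ᵢ x F) = x ∷ indVars F
indVars (∀ₚ k X F) = indVars F
indVars (∃ₚ k X F) = indVars F

predVars : Formula → List (ℕ × ℕ)
predVars (x ≐ y) = []
predVars (app k X xs) = (k , X) ∷ []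
predVars (neg F) = predVars F
predVars (and F G) = predVars F ++ₗ predVars G
predVars (or F G) = predVars F ++ₗ predVars G
predVars (imp F G) = predVars F ++ₗ predVars G
predVars (iff F G) = predVars F ++ₗ predVars G
predVars (∀ᵢ x F) = predVars F
predVars (∃ᵢ x F) = predVars F
predVars (∀ₚ k X F) = (k , X) ∷ predVars F
predVars (∃ₚ k X F) = (k , X) ∷ predVars F

∀ᵢs : {n : ℕ} → Vec ℕ n → Formula → Formula
∀ᵢs xs F = foldr _ ∀ᵢ F xs

Distinct : {n : ℕ} → Vec ℕ n → Set
Distinct {n} xs = (i j : Fin n) → lookup xs i ≡ lookup xs j → i ≡ j

DisjointV : {n m : ℕ} → Vec ℕ n → Vec ℕ m → Set
DisjointV {n} {m} xs ys = (i : Fin n) (j : Fin m) → lookup xs i ≢ lookup ys j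

-- The Ackermann axiom choice_h^{n,m}(H), for n = suc n', m = suc m':
--   ∀x ∃D H(x,D) → ∃S ∀x ∃D (∀y (D y ↔ S x y) ∧ H(x,D))
-- D has arity m = suc m' (pair (m' , D)),
-- S has arity n + m = suc (n' + suc m') (pair (n' + suc m' , S)).

choice : (n' m' : ℕ) → Vec ℕ (suc n') → Vec ℕ (suc m') → (D S : ℕ) → Formula → Formula
choice n' m' xs ys D S H =
  imp (∀ᵢs xs (∃ₚ m' D H))
      (∃ₚ (n' + suc m') S
        (∀ᵢs xs (∃ₚ m' D
          (and (∀ᵢs ys (iff (app m' D ys) (app (n' + suc m') S (xs ++ ys)))) H))))

Pred : Set → ℕ → Set
Pred I k = Vec I k → Bool

module Semantics (I : Set) (J : (k : ℕ) → Pred I (suc k) → Set) where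
  -- J (k) describes J_{suc k} ⊆ pred_{suc k}(I); J_0 = I.
  JPred : ℕ → Set
  JPred k = Σ (Pred I (suc k)) (J k)

  record Assignment : Set where
    field
      ind : ℕ → I
      prd : (k X : ℕ) → JPred k
  open Assignment public

  updInd : Assignment → ℕ → I → Assignment
  updInd σ x a = record
    { ind = λ y → upd y (x ≟ y)
    ; prd = prd σ }
    where
      upd : (y : ℕ) → Relation.Nullary.Dec (x ≡ y) → I
      upd y (yes _) = a
      upd y (no _) = ind σ y

  private
    pick : (k X : ℕ) → JPred k → (k' X' : ℕ) → JPred k' →
           Relation.Nullary.Dec (k ≡ k') → Relation.Nullary.Dec (X ≡ X') → JPred k'
    pick k X α .k X' old (yes refl) (yes _) = α
    pick k X α k' X' old _ _ = old

  updPred : Assignment → (k X : ℕ) → JPred k → Assignment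
  updPred σ k X α = record
    { ind = ind σ
    ; prd = λ k' X' → pick k X α k' X' (prd σ k' X') (k ≟ k') (X ≟ X') }

  ⟦_⟧ : Formula → Assignment → Set
  ⟦ x ≐ y ⟧ σ = ind σ x ≡ ind σ y
  ⟦ app k X xs ⟧ σ = proj₁ (prd σ k X) (map (ind σ) xs) ≡ true
  ⟦ neg F ⟧ σ = ¬ ⟦ F ⟧ σ
  ⟦ and F G ⟧ σ = ⟦ F ⟧ σ × ⟦ G ⟧ σ
  ⟦ or F G ⟧ σ = ⟦ F ⟧ σ ⊎ ⟦ G ⟧ σ
  ⟦ imp F G ⟧ σ = ⟦ F ⟧ σ → ⟦ G ⟧ σ
  ⟦ iff F G ⟧ σ = (⟦ F ⟧ σ → ⟦ G ⟧ σ) × (⟦ G ⟧ σ → ⟦ F ⟧ σ)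
  ⟦ ∀ᵢ x F ⟧ σ = (a : I) → ⟦ F ⟧ (updInd σ x a)
  ⟦ ∃ᵢ x F ⟧ σ = Σ I (λ a → ⟦ F ⟧ (updInd σ x a))
  ⟦ ∀ₚ k X F ⟧ σ = (α : JPred k) → ⟦ F ⟧ (updPred σ k X α)
  ⟦ ∃ₚ k X F ⟧ σ = Σ (JPred k) (λ α → ⟦ F ⟧ (updPred σ k X α))

  ⊨_ : Formula → Set
  ⊨ F = (σ : Assignment) → ⟦ F ⟧ σ

Perm : Set → Set
Perm I = I ↔ I

-- α^π : extension {(π ξ₁,…,π ξ_k) : ξ ∈ α̃}, i.e. α^π(v) = α(π⁻¹ v)
_^_ : {I : Set} {k : ℕ} → Pred I k → Perm I → Pred I k
(α ^ π) v = α (map (Inverse.from π) v)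

FinSupported : (I : Set) (k : ℕ) → Pred I k → Set
FinSupported I k α =
  Σ (List I) λ P → (π : Perm I) → (∀ {p} → p ∈ P → Inverse.to π p ≡ p) →
    (v : Vec I k) → (α ^ π) v ≡ α v

J₀-model : (I : Set) → (k : ℕ) → Pred I (suc k) → Set
J₀-model I k = FinSupported I (suc k)

_⊨Σ₀_ : (I : Set) → Formula → Set
I ⊨Σ₀ F = Semantics.⊨_ I (J₀-model I) F

Infinite : Set → Set
Infinite I = ¬ Σ ℕ (λ n → Fin n ↔ I)

-- Truth in the basic Fraenkel model is invariant under permutations of I, and every
-- predicate is fixed by the permutations fixing some finite set.  So the premise ∀x ∃D H
-- is a total relation R(a, δ) invariant under the permutations fixing a finite set P
-- (the values of the parameters of H).  To choose δ uniformly, send a to a canonical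
-- representative r(a), obtained by renaming the entries outside P to reserved fresh
-- points according to the equality pattern of a; r takes only finitely many values, so
-- fixing one witness δ₀(r(a)) for each involves only finitely many support points.
-- Transport δ₀(r(a)) back along a permutation πₐ with πₐ(r(a)) = a that fixes P and sends
-- the remaining support points into the first of N + 1 disjoint reserved blocks that
-- misses the N entries of a.  For ρ fixing P and the blocks, π_ρ(a) then agrees with
-- ρ ∘ πₐ on the support of δ₀(r(a)), so S(x, y) :⇔ D_x(y) is finitely supported.

module Submission where

open import Defs
open import Level using (0ℓ)
open import Axiom.ExcludedMiddle using (ExcludedMiddle)
open import Data.Empty using (⊥-elim)
open import Data.Fin using (Fin; zero; suc; combine) renaming (_≤_ to _≤ᶠ_; _<_ to _<ᶠ_)
open import Data.Nat using (ℕ; zero; suc; _+_; _*_; _≟_; z≤n; s≤s)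
open import Data.Nat.Properties using (n<1+n; m≤n+m; <-irrefl)
open import Data.Product using (Σ; _×_; _,_; proj₁; proj₂; uncurry)
open import Data.Sum using (_⊎_; inj₁; inj₂)
open import Data.List using (List; []; _∷_; allFin; concatMap; length; deduplicate)
  renaming (lookup to lookupₗ; map to mapₗ; _++_ to _++ₗ_)
open import Data.List.Membership.Propositional using (_∈_; _∉_)
open import Data.List.Membership.Propositional.Properties
  using (∈-map⁺; ∈-++⁺ˡ; ∈-++⁺ʳ; ∈-++⁻; ∈-concat⁺′; ∈-lookup; ∈-deduplicate⁺; ∈-allFin)
open import Data.List.Relation.Binary.Subset.Propositional using (_⊆_)
open import Data.List.Relation.Binary.Subset.Propositional.Properties using (⊆-refl; xs⊆xs++ys; xs⊆ys++xs; xs⊆x∷xs)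
open import Data.List.Relation.Unary.Any using (here; there; index)
import Data.List.Relation.Unary.Any.Properties as Anyₗ
import Data.List.Relation.Unary.All as All
open import Data.List.Relation.Unary.Unique.Propositional using (Unique; []; _∷_)
open import Data.List.Relation.Unary.Unique.DecPropositional.Properties using (deduplicate-!)
open import Data.Vec using (Vec; []; _∷_; map; lookup; toList; tabulate; _++_; take; drop)
open import Data.Vec.Properties
  using (map-∘; map-cong; map-id; map-++; lookup-map; lookup∘tabulate; tabulate-cong; tabulate-∘; tabulate∘lookup;
         take-map; drop-map; take++drop≡id; ++-injectiveˡ; ++-injectiveʳ)
open import Data.Vec.Membership.Propositional.Properties using (∈-toList⁻; ∈-toList⁺) renaming (∈-lookup to ∈-lookupᵥ)
import Data.Vec.Relation.Unary.Any as Anyᵥ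
open import Data.Vec.Relation.Unary.Any.Properties using (lookup-index)
open import Data.Fin.Properties using (suc-injective; ≤-antisym; combine-injective; pigeonhole)
  renaming (<-irrefl to <ᶠ-irrefl)
open import Function.Base using (_∘_)
open import Function.Bundles using (_↔_; Inverse; mk↔ₛ′)
open import Function.Construct.Identity using (↔-id)
open import Function.Construct.Composition using (_↔-∘_)
open import Function.Construct.Symmetry using (↔-sym)
open import Relation.Nullary using (¬_; Dec; yes; no)
open import Relation.Binary using (DecidableEquality)
open import Relation.Binary.PropositionalEquality

open Inverse using (to; from)

map-cong-on : ∀ {A B : Set} {n} {f g : A → B} (xs : Vec A n) →
              (∀ {x} → x ∈ toList xs → f x ≡ g x) → map f xs ≡ map g xs
map-cong-on [] _ = refl
map-cong-on (x ∷ xs) f≗g = cong₂ _∷_ (f≗g (here refl)) (map-cong-on xs (f≗g ∘ there))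

take-++ : ∀ {A : Set} {m n} (a : Vec A m) (b : Vec A n) → take m (a ++ b) ≡ a
take-++ {m = m} a b = ++-injectiveˡ (take m (a ++ b)) a (take++drop≡id m (a ++ b))

drop-++ : ∀ {A : Set} {m n} (a : Vec A m) (b : Vec A n) → drop m (a ++ b) ≡ b
drop-++ {m = m} a b = ++-injectiveʳ (take m (a ++ b)) a (take++drop≡id m (a ++ b))

∈-toList⇒lookup : ∀ {A : Set} {n} {y : A} {xs : Vec A n} → y ∈ toList xs → Σ (Fin n) λ j → lookup xs j ≡ y
∈-toList⇒lookup y∈xs = Anyᵥ.index (∈-toList⁻ y∈xs) , sym (lookup-index (∈-toList⁻ y∈xs))

module _ {I : Set} where

  to-from : (π : Perm I) (y : I) → to π (from π y) ≡ y
  to-from = Inverse.strictlyInverseˡ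

  from-to : (π : Perm I) (x : I) → from π (to π x) ≡ x
  from-to = Inverse.strictlyInverseʳ

  to-injective : (π : Perm I) {x y : I} → to π x ≡ to π y → x ≡ y
  to-injective π {x} {y} e = trans (sym (from-to π x)) (trans (cong (from π) e) (from-to π y))

  map-from-to : ∀ {n} (π : Perm I) (v : Vec I n) → map (from π) (map (to π) v) ≡ v
  map-from-to π v = trans (sym (map-∘ (from π) (to π) v)) (trans (map-cong (from-to π) v) (map-id v))

  map-to-from : ∀ {n} (π : Perm I) (v : Vec I n) → map (to π) (map (from π) v) ≡ v
  map-to-from π v = map-from-to (↔-sym π) v

  _Fixes_ : Perm I → List I → Set
  π Fixes L = ∀ {p} → p ∈ L → to π p ≡ p

  ↔-sym-fixes : ∀ {π L} → π Fixes L → ↔-sym π Fixes L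
  ↔-sym-fixes {π} fixes {p} p∈L = trans (cong (from π) (sym (fixes p∈L))) (from-to π p)

  _Supports_ : ∀ {k} → List I → Pred I k → Set
  _Supports_ {k} P α = (π : Perm I) → π Fixes P → (v : Vec I k) → (α ^ π) v ≡ α v

  ^-∘ : ∀ {k} (α : Pred I k) (π ρ : Perm I) (v : Vec I k) → ((α ^ π) ^ ρ) v ≡ (α ^ (ρ ↔-∘ π)) v
  ^-∘ α π ρ v = cong α (sym (map-∘ (from π) (from ρ) v))

  ^-resp-support : ∀ {k} {P : List I} {α : Pred I k} → P Supports α → (π π' : Perm I) →
                   (∀ {p} → p ∈ P → to π p ≡ to π' p) → (v : Vec I k) → (α ^ π) v ≡ (α ^ π') v
  ^-resp-support {k} {P} {α} supp π π' agree v = begin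
    α (map (from π) v)                         ≡⟨ cong (α ∘ map (from π)) (sym (map-to-from π' v)) ⟩
    α (map (from π) (map (to π') w))           ≡⟨ cong α (sym (map-∘ (from π) (to π') w)) ⟩
    (α ^ (↔-sym π' ↔-∘ π)) w                    ≡⟨ supp (↔-sym π' ↔-∘ π) fixes w ⟩
    α w                                        ∎
    where
    open ≡-Reasoning
    w : Vec I k
    w = map (from π') v
    fixes : (↔-sym π' ↔-∘ π) Fixes P
    fixes {p} p∈P = trans (cong (from π') (agree p∈P)) (from-to π' p)

  ^-preserves-support : ∀ {k} {P : List I} {α : Pred I k} → P Supports α →
                        (π : Perm I) → mapₗ (to π) P Supports (α ^ π)
  ^-preserves-support {α = α} supp π ρ fixes v =
    trans (^-∘ α π ρ v) (^-resp-support supp (ρ ↔-∘ π) π (λ p∈P → fixes (∈-map⁺ (to π) p∈P)) v)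

module Coincidence {I : Set} {J : (k : ℕ) → Pred I (suc k) → Set} where
  open Semantics I J

  record Agree (xs : List ℕ) (Xs : List (ℕ × ℕ)) (σ τ : Assignment) : Set where
    constructor agree
    field
      ind-≡ : ∀ {x} → x ∈ xs → ind σ x ≡ ind τ x
      prd-≗ : ∀ {k X} → (k , X) ∈ Xs → (v : Vec I (suc k)) → proj₁ (prd σ k X) v ≡ proj₁ (prd τ k X) v
  open Agree

  AgreeOn : Formula → Assignment → Assignment → Set
  AgreeOn F = Agree (indVars F) (predVars F)

  Agree-refl : ∀ {xs Xs σ} → Agree xs Xs σ σ
  Agree-refl = agree (λ _ → refl) (λ _ _ → refl)

  Agree-sym : ∀ {xs Xs σ τ} → Agree xs Xs σ τ → Agree xs Xs τ σ
  Agree-sym a = agree (sym ∘ ind-≡ a) (λ m v → sym (prd-≗ a m v))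

  Agree-trans : ∀ {xs Xs σ τ υ} → Agree xs Xs σ τ → Agree xs Xs τ υ → Agree xs Xs σ υ
  Agree-trans a b = agree (λ m → trans (ind-≡ a m) (ind-≡ b m)) (λ m v → trans (prd-≗ a m v) (prd-≗ b m v))

  Agree-mono : ∀ {xs ys Xs Ys σ τ} → xs ⊆ ys → Xs ⊆ Ys → Agree ys Ys σ τ → Agree xs Xs σ τ
  Agree-mono xs⊆ys Xs⊆Ys a = agree (ind-≡ a ∘ xs⊆ys) (prd-≗ a ∘ Xs⊆Ys)

  Agree-++ˡ : ∀ F G {σ τ} → Agree (indVars F ++ₗ indVars G) (predVars F ++ₗ predVars G) σ τ → AgreeOn F σ τ
  Agree-++ˡ F G = Agree-mono (xs⊆xs++ys _ (indVars G)) (xs⊆xs++ys _ (predVars G))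

  Agree-++ʳ : ∀ F G {σ τ} → Agree (indVars F ++ₗ indVars G) (predVars F ++ₗ predVars G) σ τ → AgreeOn G σ τ
  Agree-++ʳ F G = Agree-mono (xs⊆ys++xs _ (indVars F)) (xs⊆ys++xs _ (predVars F))

  updInd-same : ∀ σ x a → ind (updInd σ x a) x ≡ a
  updInd-same σ x a with x ≟ x
  ... | yes _ = refl
  ... | no x≢x = ⊥-elim (x≢x refl)

  updInd-other : ∀ σ x a {y} → x ≢ y → ind (updInd σ x a) y ≡ ind σ y
  updInd-other σ x a {y} x≢y with x ≟ y
  ... | yes x≡y = ⊥-elim (x≢y x≡y)
  ... | no _ = refl

  updPred-same : ∀ σ k X α → prd (updPred σ k X α) k X ≡ α
  updPred-same σ k X α with k ≟ k | X ≟ X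
  ... | yes refl | yes _ = refl
  ... | yes refl | no X≢X = ⊥-elim (X≢X refl)
  ... | no k≢k | _ = ⊥-elim (k≢k refl)

  updPred-other : ∀ σ {k X k' X'} α → ¬ (k ≡ k' × X ≡ X') → prd (updPred σ k X α) k' X' ≡ prd σ k' X'
  updPred-other σ {k} {X} {k'} {X'} α ne with k ≟ k' | X ≟ X'
  ... | yes refl | yes X≡X' = ⊥-elim (ne (refl , X≡X'))
  ... | yes refl | no _ = refl
  ... | no _ | _ = refl

  updInd-agree : ∀ {xs Xs σ τ} x a → Agree xs Xs σ τ → Agree xs Xs (updInd σ x a) (updInd τ x a)
  updInd-agree {xs} {σ = σ} {τ} x a σ≈τ = agree ind-agree (prd-≗ σ≈τ)
    where
    ind-agree : ∀ {y} → y ∈ xs → ind (updInd σ x a) y ≡ ind (updInd τ x a) y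
    ind-agree {y} y∈xs with x ≟ y
    ... | yes _ = refl
    ... | no _ = ind-≡ σ≈τ y∈xs

  updPred-agree : ∀ {xs Xs σ τ} k X {α β : JPred k} → Agree xs Xs σ τ → (∀ v → proj₁ α v ≡ proj₁ β v) →
                  Agree xs Xs (updPred σ k X α) (updPred τ k X β)
  updPred-agree {Xs = Xs} {σ} {τ} k X {α} {β} σ≈τ α≗β = agree (ind-≡ σ≈τ) prd-agree
    where
    prd-agree : ∀ {k' X'} → (k' , X') ∈ Xs → ∀ v →
                proj₁ (prd (updPred σ k X α) k' X') v ≡ proj₁ (prd (updPred τ k X β) k' X') v
    prd-agree {k'} {X'} m v with k ≟ k' | X ≟ X'
    ... | yes refl | yes _ = α≗β v
    ... | yes refl | no _ = prd-≗ σ≈τ m v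
    ... | no _ | _ = prd-≗ σ≈τ m v

  updPred-fresh : ∀ {xs Xs} σ k X (α : JPred k) → (k , X) ∉ Xs → Agree xs Xs σ (updPred σ k X α)
  updPred-fresh {Xs = Xs} σ k X α fresh = agree (λ _ → refl) prd-agree
    where
    prd-agree : ∀ {k' X'} → (k' , X') ∈ Xs → ∀ v →
                proj₁ (prd σ k' X') v ≡ proj₁ (prd (updPred σ k X α) k' X') v
    prd-agree m v = sym (cong (λ δ → proj₁ δ v) (updPred-other σ α λ { (refl , refl) → fresh m }))

  ⟦⟧-agree : ∀ F {σ τ} → AgreeOn F σ τ → ⟦ F ⟧ σ → ⟦ F ⟧ τ
  ⟦⟧-agree (x ≐ y) a h = trans (sym (ind-≡ a (here refl))) (trans h (ind-≡ a (there (here refl))))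
  ⟦⟧-agree (app k X xs) {σ} {τ} a h =
    trans (sym (trans (prd-≗ a (here refl) _) (cong (proj₁ (prd τ k X)) (map-cong-on xs (ind-≡ a))))) h
  ⟦⟧-agree (neg F) a h f = h (⟦⟧-agree F (Agree-sym a) f)
  ⟦⟧-agree (and F G) a (f , g) = ⟦⟧-agree F (Agree-++ˡ F G a) f , ⟦⟧-agree G (Agree-++ʳ F G a) g
  ⟦⟧-agree (or F G) a (inj₁ f) = inj₁ (⟦⟧-agree F (Agree-++ˡ F G a) f)
  ⟦⟧-agree (or F G) a (inj₂ g) = inj₂ (⟦⟧-agree G (Agree-++ʳ F G a) g)
  ⟦⟧-agree (imp F G) a h f =
    ⟦⟧-agree G (Agree-++ʳ F G a) (h (⟦⟧-agree F (Agree-sym (Agree-++ˡ F G a)) f))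
  ⟦⟧-agree (iff F G) {σ} {τ} a (f⇒g , g⇒f) =
    (λ f → ⟦⟧-agree G aG (f⇒g (⟦⟧-agree F (Agree-sym aF) f))) ,
    (λ g → ⟦⟧-agree F aF (g⇒f (⟦⟧-agree G (Agree-sym aG) g)))
    where
    aF : AgreeOn F σ τ
    aF = Agree-++ˡ F G a
    aG : AgreeOn G σ τ
    aG = Agree-++ʳ F G a
  ⟦⟧-agree (∀ᵢ x F) a h b = ⟦⟧-agree F (updInd-agree x b (Agree-mono (xs⊆x∷xs _ x) ⊆-refl a)) (h b)
  ⟦⟧-agree (∃ᵢ x F) a (b , h) = b , ⟦⟧-agree F (updInd-agree x b (Agree-mono (xs⊆x∷xs _ x) ⊆-refl a)) h
  ⟦⟧-agree (∀ₚ k X F) a h α =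
    ⟦⟧-agree F (updPred-agree k X (Agree-mono ⊆-refl (xs⊆x∷xs _ _) a) (λ _ → refl)) (h α)
  ⟦⟧-agree (∃ₚ k X F) a (α , h) =
    α , ⟦⟧-agree F (updPred-agree k X (Agree-mono ⊆-refl (xs⊆x∷xs _ _) a) (λ _ → refl)) h

  _⟨_≔_⟩ : ∀ {n} → Assignment → Vec ℕ n → Vec I n → Assignment
  σ ⟨ [] ≔ [] ⟩ = σ
  σ ⟨ x ∷ xs ≔ a ∷ as ⟩ = updInd σ x a ⟨ xs ≔ as ⟩

  ∀ᵢs-elim : ∀ {n} (xs : Vec ℕ n) F σ → ⟦ ∀ᵢs xs F ⟧ σ → ∀ as → ⟦ F ⟧ (σ ⟨ xs ≔ as ⟩)
  ∀ᵢs-elim [] F σ h [] = h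
  ∀ᵢs-elim (x ∷ xs) F σ h (a ∷ as) = ∀ᵢs-elim xs F (updInd σ x a) (h a) as

  ∀ᵢs-intro : ∀ {n} (xs : Vec ℕ n) F σ → (∀ as → ⟦ F ⟧ (σ ⟨ xs ≔ as ⟩)) → ⟦ ∀ᵢs xs F ⟧ σ
  ∀ᵢs-intro [] F σ h = h []
  ∀ᵢs-intro (x ∷ xs) F σ h a = ∀ᵢs-intro xs F (updInd σ x a) (h ∘ (a ∷_))

  updInds-prd : ∀ {n} σ (xs : Vec ℕ n) as → prd (σ ⟨ xs ≔ as ⟩) ≡ prd σ
  updInds-prd σ [] [] = refl
  updInds-prd σ (x ∷ xs) (a ∷ as) = updInds-prd (updInd σ x a) xs as

  updInds-updPred-same : ∀ {n} σ (xs : Vec ℕ n) as k X α → prd (updPred σ k X α ⟨ xs ≔ as ⟩) k X ≡ α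
  updInds-updPred-same σ xs as k X α = trans (cong (λ p → p k X) (updInds-prd _ xs as)) (updPred-same σ k X α)

  updInds-updPred-other : ∀ {n} σ (xs : Vec ℕ n) as {k X k' X'} α → ¬ (k ≡ k' × X ≡ X') →
                          prd (updPred σ k X α ⟨ xs ≔ as ⟩) k' X' ≡ prd σ k' X'
  updInds-updPred-other σ xs as {k' = k'} {X'} α ne =
    trans (cong (λ p → p k' X') (updInds-prd _ xs as)) (updPred-other σ α ne)

  updInds-agree : ∀ {n ys Ys σ τ} (xs : Vec ℕ n) as → Agree ys Ys σ τ →
                  Agree ys Ys (σ ⟨ xs ≔ as ⟩) (τ ⟨ xs ≔ as ⟩)
  updInds-agree [] [] σ≈τ = σ≈τ
  updInds-agree (x ∷ xs) (a ∷ as) σ≈τ = updInds-agree xs as (updInd-agree x a σ≈τ)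

  updInds-other : ∀ {n} σ (xs : Vec ℕ n) as {y} → y ∉ toList xs → ind (σ ⟨ xs ≔ as ⟩) y ≡ ind σ y
  updInds-other σ [] [] y∉xs = refl
  updInds-other σ (x ∷ xs) (a ∷ as) y∉xs =
    trans (updInds-other (updInd σ x a) xs as (y∉xs ∘ there)) (updInd-other σ x a (λ { refl → y∉xs (here refl) }))

  updInds-lookup : ∀ {n} σ (xs : Vec ℕ n) as → Distinct xs → map (ind (σ ⟨ xs ≔ as ⟩)) xs ≡ as
  updInds-lookup σ [] [] _ = refl
  updInds-lookup σ (x ∷ xs) (a ∷ as) distinct =
    cong₂ _∷_ (trans (updInds-other (updInd σ x a) xs as x∉xs) (updInd-same σ x a))
              (updInds-lookup (updInd σ x a) xs as (λ i j e → suc-injective (distinct (suc i) (suc j) e)))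
    where
    x∉xs : x ∉ toList xs
    x∉xs x∈xs with ∈-toList⇒lookup x∈xs
    ... | j , xs[j]≡x with distinct zero (suc j) (sym xs[j]≡x)
    ... | ()

module Invariance (I : Set) where
  open Semantics I (J₀-model I)
  open Coincidence {I} {J₀-model I}

  supportOf : ∀ {k} → JPred k → List I
  supportOf = proj₁ ∘ proj₂

  _·_ : ∀ {k} → Perm I → JPred k → JPred k
  π · (α , P , P-supports-α) = α ^ π , mapₗ (to π) P , ^-preserves-support P-supports-α π

  act : Perm I → Assignment → Assignment
  act π σ = record { ind = to π ∘ ind σ ; prd = λ k X → π · prd σ k X }

  act-updInd : ∀ {xs Xs} π σ x a → Agree xs Xs (act π (updInd σ x a)) (updInd (act π σ) x (to π a))
  act-updInd {xs} π σ x a = agree ind-agree (λ _ _ → refl)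
    where
    ind-agree : ∀ {y} → y ∈ xs → ind (act π (updInd σ x a)) y ≡ ind (updInd (act π σ) x (to π a)) y
    ind-agree {y} _ with x ≟ y
    ... | yes _ = refl
    ... | no _ = refl

  act-updPred : ∀ {xs Xs} π σ k X α → Agree xs Xs (act π (updPred σ k X α)) (updPred (act π σ) k X (π · α))
  act-updPred {Xs = Xs} π σ k X α = agree (λ _ → refl) prd-agree
    where
    prd-agree : ∀ {k' X'} → (k' , X') ∈ Xs → ∀ v → proj₁ (prd (act π (updPred σ k X α)) k' X') v ≡
                                       proj₁ (prd (updPred (act π σ) k X (π · α)) k' X') v
    prd-agree {k'} {X'} _ v with k ≟ k' | X ≟ X'
    ... | yes refl | yes _ = refl
    ... | yes refl | no _ = refl
    ... | no _ | _ = refl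

  act-updInds : ∀ {n ys Ys} π σ (xs : Vec ℕ n) as →
                Agree ys Ys (act π (σ ⟨ xs ≔ as ⟩)) (act π σ ⟨ xs ≔ map (to π) as ⟩)
  act-updInds π σ [] [] = Agree-refl
  act-updInds π σ (x ∷ xs) (a ∷ as) =
    Agree-trans (act-updInds π (updInd σ x a) xs as) (updInds-agree xs (map (to π) as) (act-updInd π σ x a))

  act-inverse : ∀ {xs Xs} π σ → Agree xs Xs (act (↔-sym π) (act π σ)) σ
  act-inverse π σ = agree (λ {x} _ → from-to π (ind σ x))
                          (λ {k} {X} _ v → cong (proj₁ (prd σ k X)) (map-from-to π v))

  ⟦⟧-act : ∀ F π σ → ⟦ F ⟧ σ → ⟦ F ⟧ (act π σ)
  ⟦⟧-act⁻ : ∀ F π σ → ⟦ F ⟧ (act π σ) → ⟦ F ⟧ σ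

  ⟦⟧-act⁻ F π σ h = ⟦⟧-agree F (act-inverse π σ) (⟦⟧-act F (↔-sym π) (act π σ) h)

  ⟦⟧-act (x ≐ y) π σ h = cong (to π) h
  ⟦⟧-act (app k X xs) π σ h =
    trans (cong (proj₁ (prd σ k X)) (trans (cong (map (from π)) (map-∘ (to π) (ind σ) xs)) (map-from-to π _))) h
  ⟦⟧-act (neg F) π σ h f = h (⟦⟧-act⁻ F π σ f)
  ⟦⟧-act (and F G) π σ (f , g) = ⟦⟧-act F π σ f , ⟦⟧-act G π σ g
  ⟦⟧-act (or F G) π σ (inj₁ f) = inj₁ (⟦⟧-act F π σ f)
  ⟦⟧-act (or F G) π σ (inj₂ g) = inj₂ (⟦⟧-act G π σ g)
  ⟦⟧-act (imp F G) π σ h f = ⟦⟧-act G π σ (h (⟦⟧-act⁻ F π σ f))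
  ⟦⟧-act (iff F G) π σ (f⇒g , g⇒f) =
    (λ f → ⟦⟧-act G π σ (f⇒g (⟦⟧-act⁻ F π σ f))) ,
    (λ g → ⟦⟧-act F π σ (g⇒f (⟦⟧-act⁻ G π σ g)))
  ⟦⟧-act (∀ᵢ x F) π σ h b =
    subst (λ c → ⟦ F ⟧ (updInd (act π σ) x c)) (to-from π b)
          (⟦⟧-agree F (act-updInd π σ x (from π b)) (⟦⟧-act F π _ (h (from π b))))
  ⟦⟧-act (∃ᵢ x F) π σ (a , h) = to π a , ⟦⟧-agree F (act-updInd π σ x a) (⟦⟧-act F π _ h)
  ⟦⟧-act (∀ₚ k X F) π σ h β =
    ⟦⟧-agree F (Agree-trans (act-updPred π σ k X (↔-sym π · β))
                            (updPred-agree k X Agree-refl (cong (proj₁ β) ∘ map-to-from π)))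
               (⟦⟧-act F π _ (h (↔-sym π · β)))
  ⟦⟧-act (∃ₚ k X F) π σ (α , h) = π · α , ⟦⟧-agree F (act-updPred π σ k X α) (⟦⟧-act F π _ h)

  supportAt : Assignment → ℕ × ℕ → List I
  supportAt σ (k , X) = supportOf (prd σ k X)

  support : Formula → Assignment → List I
  support F σ = mapₗ (ind σ) (indVars F) ++ₗ concatMap (supportAt σ) (predVars F)

  act-fixing-support : ∀ F π σ → π Fixes support F σ → AgreeOn F (act π σ) σ
  act-fixing-support F π σ fixes = agree
    (λ x∈F → fixes (∈-++⁺ˡ (∈-map⁺ (ind σ) x∈F)))
    (λ {k} {X} X∈F → proj₂ (proj₂ (prd σ k X)) π
       (λ p∈ → fixes (∈-++⁺ʳ _ (∈-concat⁺′ p∈ (∈-map⁺ (supportAt σ) X∈F)))))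

module _ {I : Set} (_≟ᴵ_ : DecidableEquality I) where

  swap : I → I → I → I
  swap u w z with z ≟ᴵ u
  ... | yes _ = w
  ... | no _ with z ≟ᴵ w
  ...   | yes _ = u
  ...   | no _ = z

  swap-left : ∀ u w → swap u w u ≡ w
  swap-left u w with u ≟ᴵ u
  ... | yes _ = refl
  ... | no u≢u = ⊥-elim (u≢u refl)

  swap-right : ∀ u w → swap u w w ≡ u
  swap-right u w with w ≟ᴵ u
  ... | yes w≡u = w≡u
  ... | no _ with w ≟ᴵ w
  ...   | yes _ = refl
  ...   | no w≢w = ⊥-elim (w≢w refl)

  swap-other : ∀ u w z → z ≢ u → z ≢ w → swap u w z ≡ z
  swap-other u w z z≢u z≢w with z ≟ᴵ u
  ... | yes z≡u = ⊥-elim (z≢u z≡u)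
  ... | no _ with z ≟ᴵ w
  ...   | yes z≡w = ⊥-elim (z≢w z≡w)
  ...   | no _ = refl

  swap-involutive : ∀ u w z → swap u w (swap u w z) ≡ z
  swap-involutive u w z with z ≟ᴵ u
  ... | yes refl = swap-right z w
  ... | no z≢u with z ≟ᴵ w
  ...   | yes refl = swap-left u z
  ...   | no z≢w = swap-other u w z z≢u z≢w

  transposition : I → I → Perm I
  transposition u w = mk↔ₛ′ (swap u w) (swap u w) (swap-involutive u w) (swap-involutive u w)

  -- Having extended g on the tail, one transposition moves the image of the head into place.
  extend-injection : (X : List I) (g : I → I) → (∀ {z z'} → z ∈ X → z' ∈ X → g z ≡ g z' → z ≡ z') →
                     Σ (Perm I) λ π → ∀ {z} → z ∈ X → to π z ≡ g z
  extend-injection [] g _ = ↔-id I , λ ()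
  extend-injection (x ∷ X) g g-injective = π , π≗g
    where
    IH : Σ (Perm I) λ π → ∀ {z} → z ∈ X → to π z ≡ g z
    IH = extend-injection X g (λ z∈X z'∈X → g-injective (there z∈X) (there z'∈X))
    π' π : Perm I
    π' = proj₁ IH
    π = transposition (to π' x) (g x) ↔-∘ π'
    π≗g : ∀ {z} → z ∈ x ∷ X → to π z ≡ g z
    π≗g (here refl) = swap-left (to π' x) (g x)
    π≗g {z} (there z∈X) with z ≟ᴵ x
    ... | yes refl = swap-left (to π' x) (g x)
    ... | no z≢x = trans (cong (swap (to π' x) (g x)) (proj₂ IH z∈X))
                         (swap-other (to π' x) (g x) (g z)
                           (λ gz≡π'x → z≢x (to-injective π' (trans (proj₂ IH z∈X) gz≡π'x)))
                           (λ gz≡gx → z≢x (g-injective (there z∈X) (here refl) gz≡gx)))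

least : ∀ {n} {P : Fin n → Set} → (∀ i → Dec (P i)) → Σ (Fin n) P → Fin n
least {zero} P? (() , _)
least {suc n} {P} P? witness with P? zero
... | yes _ = zero
... | no ¬P0 = suc (least (P? ∘ suc) (shift witness))
  where
  shift : Σ (Fin (suc n)) P → Σ (Fin n) (P ∘ suc)
  shift (zero , P0) = ⊥-elim (¬P0 P0)
  shift (suc i , Pi) = i , Pi

least-holds : ∀ {n} {P : Fin n → Set} (P? : ∀ i → Dec (P i)) (w : Σ (Fin n) P) → P (least P? w)
least-holds {zero} P? (() , _)
least-holds {suc n} P? w with P? zero
... | yes P0 = P0
... | no ¬P0 = least-holds (P? ∘ suc) _

least-minimal : ∀ {n} {P : Fin n → Set} (P? : ∀ i → Dec (P i)) (w : Σ (Fin n) P) →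
                ∀ {j} → P j → least P? w ≤ᶠ j
least-minimal {zero} P? (() , _)
least-minimal {suc n} P? w {j} Pj with P? zero
... | yes _ = z≤n
least-minimal {suc n} P? w {zero} Pj | no ¬P0 = ⊥-elim (¬P0 Pj)
least-minimal {suc n} P? w {suc j} Pj | no ¬P0 = s≤s (least-minimal (P? ∘ suc) _ Pj)

least-cong : ∀ {n} {P Q : Fin n → Set} (P? : ∀ i → Dec (P i)) (Q? : ∀ i → Dec (Q i)) →
             (∀ i → P i → Q i) → (∀ i → Q i → P i) →
             (v : Σ (Fin n) P) (w : Σ (Fin n) Q) → least P? v ≡ least Q? w
least-cong P? Q? P⇒Q Q⇒P v w = ≤-antisym
  (least-minimal P? v (Q⇒P _ (least-holds Q? w)))
  (least-minimal Q? w (P⇒Q _ (least-holds P? v)))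

lookup-injective : ∀ {A : Set} {xs : List A} → Unique xs → ∀ i j → lookupₗ xs i ≡ lookupₗ xs j → i ≡ j
lookup-injective (_ ∷ _) zero zero _ = refl
lookup-injective (x≢xs ∷ _) zero (suc j) e = ⊥-elim (All.lookup x≢xs (∈-lookup j) e)
lookup-injective (x≢xs ∷ _) (suc i) zero e = ⊥-elim (All.lookup x≢xs (∈-lookup i) (sym e))
lookup-injective (_ ∷ unique) (suc i) (suc j) e = cong suc (lookup-injective unique i j e)

enumeration⇒Fin↔ : ∀ {A : Set} → DecidableEquality A → (L : List A) → (∀ z → z ∈ L) →
                   Σ ℕ λ n → Fin n ↔ A
enumeration⇒Fin↔ {A} _≟ᴬ_ L enumerates = length U , mk↔ₛ′ (lookupₗ U) position lookup-position position-lookup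
  where
  U : List A
  U = deduplicate _≟ᴬ_ L
  position : A → Fin (length U)
  position z = index (∈-deduplicate⁺ _≟ᴬ_ (enumerates z))
  lookup-position : ∀ z → lookupₗ U (position z) ≡ z
  lookup-position z = sym (Anyₗ.lookup-index (∈-deduplicate⁺ _≟ᴬ_ (enumerates z)))
  position-lookup : ∀ i → position (lookupₗ U i) ≡ i
  position-lookup i = lookup-injective (deduplicate-! _≟ᴬ_ L) _ _ (lookup-position (lookupₗ U i))

module _ (em : ExcludedMiddle 0ℓ) {I : Set} (infinite : Infinite I) where

  fresh : (L : List I) → Σ I (_∉ L)
  fresh L with em {Σ I (_∉ L)}
  ... | yes z∉L = z∉L
  ... | no ¬fresh = ⊥-elim (infinite (enumeration⇒Fin↔ (λ _ _ → em) L enumerates))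
    where
    enumerates : ∀ z → z ∈ L
    enumerates z with em {z ∈ L}
    ... | yes z∈L = z∈L
    ... | no z∉L = ⊥-elim (¬fresh (z , z∉L))

  fresh-injection : (L : List I) (n : ℕ) →
                    Σ (Fin n → I) λ f → (∀ {i j} → f i ≡ f j → i ≡ j) × (∀ i → f i ∉ L)
  fresh-injection L zero = (λ ()) , (λ { {()} }) , (λ ())
  fresh-injection L (suc n) = f , f-injective , f-fresh
    where
    z : Σ I (_∉ L)
    z = fresh L
    IH : Σ (Fin n → I) λ f → (∀ {i j} → f i ≡ f j → i ≡ j) × (∀ i → f i ∉ proj₁ z ∷ L)
    IH = fresh-injection (proj₁ z ∷ L) n
    f : Fin (suc n) → I
    f zero = proj₁ z
    f (suc i) = proj₁ IH i
    f-injective : ∀ {i j} → f i ≡ f j → i ≡ j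
    f-injective {zero} {zero} _ = refl
    f-injective {zero} {suc j} e = ⊥-elim (proj₂ (proj₂ IH) j (here (sym e)))
    f-injective {suc i} {zero} e = ⊥-elim (proj₂ (proj₂ IH) i (here e))
    f-injective {suc i} {suc j} e = cong suc (proj₁ (proj₂ IH) e)
    f-fresh : ∀ i → f i ∉ L
    f-fresh zero = proj₂ z
    f-fresh (suc i) = proj₂ (proj₂ IH) i ∘ there

vectorsOver : ∀ {A : Set} → List A → (n : ℕ) → List (Vec A n)
vectorsOver L zero = [] ∷ []
vectorsOver L (suc n) = concatMap (λ x → mapₗ (x ∷_) (vectorsOver L n)) L

∈-vectorsOver : ∀ {A : Set} {n} (L : List A) (v : Vec A n) → (∀ j → lookup v j ∈ L) → v ∈ vectorsOver L n
∈-vectorsOver L [] _ = here refl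
∈-vectorsOver L (x ∷ v) entries∈L =
  ∈-concat⁺′ (∈-map⁺ (x ∷_) (∈-vectorsOver L v (entries∈L ∘ suc)))
             (∈-map⁺ (λ y → mapₗ (y ∷_) (vectorsOver L _)) (entries∈L zero))

module Uniformization
  (em : ExcludedMiddle 0ℓ) {I : Set} (infinite : Infinite I) {N k : ℕ}
  (P : List I) (R : Vec I N → Semantics.JPred I (J₀-model I) k → Set)
  (R-invariant : ∀ π → π Fixes P → ∀ a δ → R a δ → R (map (to π) a) (Invariance._·_ I π δ))
  (R-total : ∀ a → Σ (Semantics.JPred I (J₀-model I) k) (R a))
  where
  open Semantics I (J₀-model I) using (JPred)
  open Invariance I using (_·_; supportOf)

  δ₀ : Vec I N → JPred k
  δ₀ a = proj₁ (R-total a)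

  C : Fin N → I
  C = proj₁ (fresh-injection em infinite P N)

  C-injective : ∀ {f f'} → C f ≡ C f' → f ≡ f'
  C-injective = proj₁ (proj₂ (fresh-injection em infinite P N))

  C-fresh : ∀ f → C f ∉ P
  C-fresh = proj₂ (proj₂ (fresh-injection em infinite P N))

  firstOccurrence : Vec I N → Fin N → Fin N
  firstOccurrence a j = least (λ j' → em {lookup a j' ≡ lookup a j}) (j , refl)

  firstOccurrence-≡ : ∀ a j → lookup a (firstOccurrence a j) ≡ lookup a j
  firstOccurrence-≡ a j = least-holds {P = λ j' → lookup a j' ≡ lookup a j} (λ j' → em) (j , refl)

  firstOccurrence-cong : ∀ a {j j'} → lookup a j ≡ lookup a j' → firstOccurrence a j ≡ firstOccurrence a j'
  firstOccurrence-cong a aj≡aj' = least-cong (λ _ → em) (λ _ → em)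
    (λ _ e → trans e aj≡aj') (λ _ e → trans e (sym aj≡aj')) _ _

  firstOccurrence-act : ∀ ρ a j → firstOccurrence (map (to ρ) a) j ≡ firstOccurrence a j
  firstOccurrence-act ρ a j = least-cong (λ _ → em) (λ _ → em)
    (λ j' e → to-injective ρ (trans (sym (lookup-map j' (to ρ) a)) (trans e (lookup-map j (to ρ) a))))
    (λ j' e → trans (lookup-map j' (to ρ) a) (trans (cong (to ρ) e) (sym (lookup-map j (to ρ) a)))) _ _

  representative : (x : I) → Dec (x ∈ P) → Fin N → I
  representative x (yes _) _ = x
  representative x (no _) f = C f

  representative-P : ∀ {x} d f → x ∈ P → representative x d f ≡ x
  representative-P (yes _) f _ = refl
  representative-P (no x∉P) f x∈P = ⊥-elim (x∉P x∈P)

  representative-∈P : ∀ x d f → representative x d f ∈ P → representative x d f ≡ x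
  representative-∈P x (yes _) f _ = refl
  representative-∈P x (no _) f Cf∈P = ⊥-elim (C-fresh f Cf∈P)

  representative-∈ : ∀ x d f → representative x d f ∈ P ++ₗ mapₗ C (allFin N)
  representative-∈ x (yes x∈P) f = ∈-++⁺ˡ x∈P
  representative-∈ x (no _) f = ∈-++⁺ʳ P (∈-map⁺ C (∈-allFin f))

  representative-cong : ∀ {x x' f f'} d d' → x ≡ x' → f ≡ f' → representative x d f ≡ representative x' d' f'
  representative-cong (yes _) (yes _) x≡x' _ = x≡x'
  representative-cong (yes x∈P) (no x'∉P) refl _ = ⊥-elim (x'∉P x∈P)
  representative-cong (no x∉P) (yes x'∈P) refl _ = ⊥-elim (x∉P x'∈P)
  representative-cong (no _) (no _) _ refl = refl

  representative-injective : ∀ {x x' f f'} d d' → representative x d f ≡ representative x' d' f' → x ≡ x' ⊎ f ≡ f'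
  representative-injective (yes _) (yes _) e = inj₁ e
  representative-injective {f' = f'} (yes x∈P) (no _) e = ⊥-elim (C-fresh f' (subst (_∈ P) e x∈P))
  representative-injective {f = f} (no _) (yes x'∈P) e = ⊥-elim (C-fresh f (subst (_∈ P) (sym e) x'∈P))
  representative-injective (no _) (no _) e = inj₂ (C-injective e)

  representative-act : ∀ ρ → ρ Fixes P → ∀ {x} d d' f → representative (to ρ x) d f ≡ representative x d' f
  representative-act ρ fixes (yes _) (yes x∈P) f = fixes x∈P
  representative-act ρ fixes {x} (yes ρx∈P) (no x∉P) f =
    ⊥-elim (x∉P (subst (_∈ P) (to-injective ρ (fixes ρx∈P)) ρx∈P))
  representative-act ρ fixes (no ρx∉P) (yes x∈P) f = ⊥-elim (ρx∉P (subst (_∈ P) (sym (fixes x∈P)) x∈P))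
  representative-act ρ fixes (no _) (no _) f = refl

  canonical : Vec I N → Vec I N
  canonical a = tabulate λ j → representative (lookup a j) em (firstOccurrence a j)

  canonical-lookup : ∀ a j → lookup (canonical a) j ≡ representative (lookup a j) em (firstOccurrence a j)
  canonical-lookup a j = lookup∘tabulate _ j

  canonical-act : ∀ ρ → ρ Fixes P → ∀ a → canonical (map (to ρ) a) ≡ canonical a
  canonical-act ρ fixes a = tabulate-cong λ j →
    trans (representative-cong em em (lookup-map j (to ρ) a) (firstOccurrence-act ρ a j))
          (representative-act ρ fixes em em (firstOccurrence a j))

  canonical-P : ∀ a j → lookup a j ∈ P → lookup (canonical a) j ≡ lookup a j
  canonical-P a j aj∈P = trans (canonical-lookup a j) (representative-P em _ aj∈P)

  canonical-∈P : ∀ a j → lookup (canonical a) j ∈ P → lookup (canonical a) j ≡ lookup a j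
  canonical-∈P a j cj∈P = trans (canonical-lookup a j)
    (representative-∈P _ em _ (subst (_∈ P) (canonical-lookup a j) cj∈P))

  canonical-cong : ∀ a {j j'} → lookup a j ≡ lookup a j' → lookup (canonical a) j ≡ lookup (canonical a) j'
  canonical-cong a {j} {j'} aj≡aj' = trans (canonical-lookup a j)
    (trans (representative-cong em em aj≡aj' (firstOccurrence-cong a aj≡aj')) (sym (canonical-lookup a j')))

  canonical-injective : ∀ a {j j'} → lookup (canonical a) j ≡ lookup (canonical a) j' → lookup a j ≡ lookup a j'
  canonical-injective a {j} {j'} cj≡cj'
    with representative-injective em em (trans (sym (canonical-lookup a j)) (trans cj≡cj' (canonical-lookup a j')))
  ... | inj₁ aj≡aj' = aj≡aj'
  ... | inj₂ same = trans (sym (firstOccurrence-≡ a j)) (trans (cong (lookup a) same) (firstOccurrence-≡ a j'))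

  E : List I
  E = concatMap (supportOf ∘ δ₀) (vectorsOver (P ++ₗ mapₗ C (allFin N)) N)

  support⊆E : ∀ a {z} → z ∈ supportOf (δ₀ (canonical a)) → z ∈ E
  support⊆E a z∈supp = ∈-concat⁺′ z∈supp (∈-map⁺ (supportOf ∘ δ₀) (∈-vectorsOver _ (canonical a) entries))
    where
    entries : ∀ j → lookup (canonical a) j ∈ P ++ₗ mapₗ C (allFin N)
    entries j = subst (_∈ P ++ₗ mapₗ C (allFin N)) (sym (canonical-lookup a j)) (representative-∈ _ em _)

  ℓ : ℕ
  ℓ = length E

  B₀ : Fin (suc N * ℓ) → I
  B₀ = proj₁ (fresh-injection em infinite P (suc N * ℓ))

  B : Fin (suc N) → Fin ℓ → I
  B i e = B₀ (combine i e)

  B-injective : ∀ i e i' e' → B i e ≡ B i' e' → i ≡ i' × e ≡ e'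
  B-injective i e i' e' q = combine-injective i e i' e' (proj₁ (proj₂ (fresh-injection em infinite P _)) q)

  B-fresh : ∀ i e → B i e ∉ P
  B-fresh i e = proj₂ (proj₂ (fresh-injection em infinite P _)) (combine i e)

  Q : List I
  Q = P ++ₗ mapₗ B₀ (allFin (suc N * ℓ))

  B∈Q : ∀ i e → B i e ∈ Q
  B∈Q i e = ∈-++⁺ʳ P (∈-map⁺ B₀ (∈-allFin (combine i e)))

  Avoids : Vec I N → Fin (suc N) → Set
  Avoids a i = ∀ e j → B i e ≢ lookup a j

  -- N + 1 pairwise disjoint blocks cannot all meet the N entries of a.
  avoiding-block-exists : ∀ a → Σ (Fin (suc N)) (Avoids a)
  avoiding-block-exists a with em {Σ (Fin (suc N)) (Avoids a)}
  ... | yes avoiding = avoiding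
  ... | no ¬avoiding = ⊥-elim (collision (pigeonhole (n<1+n N) (proj₁ ∘ proj₂ ∘ hit)))
    where
    Hits : Fin (suc N) → Set
    Hits i = Σ (Fin ℓ) λ e → Σ (Fin N) λ j → B i e ≡ lookup a j
    hit : ∀ i → Hits i
    hit i with em {Hits i}
    ... | yes h = h
    ... | no ¬h = ⊥-elim (¬avoiding (i , λ e j q → ¬h (e , j , q)))
    collision : ¬ Σ (Fin (suc N)) λ i → Σ (Fin (suc N)) λ i' →
                  i <ᶠ i' × proj₁ (proj₂ (hit i)) ≡ proj₁ (proj₂ (hit i'))
    collision (i , i' , i<i' , same) = <ᶠ-irrefl (proj₁ (B-injective i _ i' _ meet)) i<i'
      where
      meet : B i (proj₁ (hit i)) ≡ B i' (proj₁ (hit i'))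
      meet = trans (proj₂ (proj₂ (hit i))) (trans (cong (lookup a) same) (sym (proj₂ (proj₂ (hit i')))))

  avoidingBlock : Vec I N → Fin (suc N)
  avoidingBlock a = least (λ i → em) (avoiding-block-exists a)

  avoidingBlock-avoids : ∀ a → Avoids a (avoidingBlock a)
  avoidingBlock-avoids a = least-holds (λ i → em) (avoiding-block-exists a)

  avoidingBlock-act : ∀ ρ → ρ Fixes Q → ∀ a → avoidingBlock (map (to ρ) a) ≡ avoidingBlock a
  avoidingBlock-act ρ fixes a = least-cong (λ _ → em) (λ _ → em) ρa⇒a a⇒ρa _ _
    where
    ρa⇒a : ∀ i → Avoids (map (to ρ) a) i → Avoids a i
    ρa⇒a i avoids e j q =
      avoids e j (trans (sym (fixes (B∈Q i e))) (trans (cong (to ρ) q) (sym (lookup-map j (to ρ) a))))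
    a⇒ρa : ∀ i → Avoids a i → Avoids (map (to ρ) a) i
    a⇒ρa i avoids e j q = avoids e j (to-injective ρ (trans (fixes (B∈Q i e)) (trans q (lookup-map j (to ρ) a))))

  relabel : (v a : Vec I N) (i : Fin (suc N)) (z : I) →
            Dec (z ∈ P) → Dec (Σ (Fin N) λ j → lookup v j ≡ z) → Dec (z ∈ E) → I
  relabel v a i z (yes _) _ _ = z
  relabel v a i z (no _) (yes (j , _)) _ = lookup a j
  relabel v a i z (no _) (no _) (yes z∈E) = B i (index z∈E)
  relabel v a i z (no _) (no _) (no _) = z

  data Kind (v a : Vec I N) (i : Fin (suc N)) (z : I) : I → Set where
    fixed : z ∈ P → Kind v a i z z
    entry : ∀ j → lookup v j ≡ z → Kind v a i z (lookup a j)
    spare : ∀ e → lookupₗ E e ≡ z → z ∉ P → (∀ j → lookup v j ≢ z) → Kind v a i z (B i e)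

  relabel-kind : ∀ v a i z dP dv dE → (z ∉ P → (∀ j → lookup v j ≢ z) → z ∈ E) →
                 Kind v a i z (relabel v a i z dP dv dE)
  relabel-kind v a i z (yes z∈P) _ _ _ = fixed z∈P
  relabel-kind v a i z (no _) (yes (j , vj≡z)) _ _ = entry j vj≡z
  relabel-kind v a i z (no z∉P) (no ¬entry) (yes z∈E) _ =
    spare (index z∈E) (sym (Anyₗ.lookup-index z∈E)) z∉P (λ j vj≡z → ¬entry (j , vj≡z))
  relabel-kind v a i z (no z∉P) (no ¬entry) (no z∉E) z∈E =
    ⊥-elim (z∉E (z∈E z∉P λ j vj≡z → ¬entry (j , vj≡z)))

  relabel-act : ∀ ρ → ρ Fixes Q → ∀ v a i z dP dv dE → z ∈ E →
                relabel v (map (to ρ) a) i z dP dv dE ≡ to ρ (relabel v a i z dP dv dE)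
  relabel-act ρ fixes v a i z (yes z∈P) _ _ _ = sym (fixes (∈-++⁺ˡ z∈P))
  relabel-act ρ fixes v a i z (no _) (yes (j , _)) _ _ = lookup-map j (to ρ) a
  relabel-act ρ fixes v a i z (no _) (no _) (yes z∈E) _ = sym (fixes (B∈Q i (index z∈E)))
  relabel-act ρ fixes v a i z (no _) (no _) (no z∉E) z∈E = ⊥-elim (z∉E z∈E)

  domain : Vec I N → List I
  domain a = P ++ₗ toList (canonical a) ++ₗ supportOf (δ₀ (canonical a))

  relabelₐ : Vec I N → I → I
  relabelₐ a z = relabel (canonical a) a (avoidingBlock a) z em em em

  relabelₐ-kind : ∀ a {z} → z ∈ domain a → Kind (canonical a) a (avoidingBlock a) z (relabelₐ a z)
  relabelₐ-kind a {z} z∈domain = relabel-kind (canonical a) a (avoidingBlock a) z em em em z∈E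
    where
    z∈E : z ∉ P → (∀ j → lookup (canonical a) j ≢ z) → z ∈ E
    z∈E z∉P ¬entry with ∈-++⁻ P z∈domain
    ... | inj₁ z∈P = ⊥-elim (z∉P z∈P)
    ... | inj₂ z∈rest with ∈-++⁻ (toList (canonical a)) z∈rest
    ...   | inj₁ z∈canonical = ⊥-elim (uncurry ¬entry (∈-toList⇒lookup z∈canonical))
    ...   | inj₂ z∈supp = support⊆E a z∈supp

  kinds-injective : ∀ a {z z' w w'} → Kind (canonical a) a (avoidingBlock a) z w →
                    Kind (canonical a) a (avoidingBlock a) z' w' → w ≡ w' → z ≡ z'
  kinds-injective a (fixed _) (fixed _) q = q
  kinds-injective a (fixed z∈P) (entry j' cj'≡z') q =
    trans q (trans (sym (canonical-P a j' (subst (_∈ P) q z∈P))) cj'≡z')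
  kinds-injective a (fixed z∈P) (spare e' _ _ _) refl = ⊥-elim (B-fresh (avoidingBlock a) e' z∈P)
  kinds-injective a (entry j cj≡z) (fixed z'∈P) q =
    trans (sym cj≡z) (trans (canonical-P a j (subst (_∈ P) (sym q) z'∈P)) q)
  kinds-injective a (entry j cj≡z) (entry j' cj'≡z') q = trans (sym cj≡z) (trans (canonical-cong a q) cj'≡z')
  kinds-injective a (entry j _) (spare e' _ _ _) q = ⊥-elim (avoidingBlock-avoids a e' j (sym q))
  kinds-injective a (spare e _ _ _) (fixed z'∈P) refl = ⊥-elim (B-fresh (avoidingBlock a) e z'∈P)
  kinds-injective a (spare e _ _ _) (entry j' _) q = ⊥-elim (avoidingBlock-avoids a e j' q)
  kinds-injective a (spare e Ee≡z _ _) (spare e' Ee'≡z' _ _) q =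
    trans (sym Ee≡z) (trans (cong (lookupₗ E) (proj₂ (B-injective i e i e' q))) Ee'≡z')
    where
    i : Fin (suc N)
    i = avoidingBlock a

  relabelₐ-injective : ∀ a {z z'} → z ∈ domain a → z' ∈ domain a → relabelₐ a z ≡ relabelₐ a z' → z ≡ z'
  relabelₐ-injective a z∈ z'∈ = kinds-injective a (relabelₐ-kind a z∈) (relabelₐ-kind a z'∈)

  πₐ : Vec I N → Perm I
  πₐ a = proj₁ (extend-injection (λ _ _ → em) (domain a) (relabelₐ a) (relabelₐ-injective a))

  πₐ-relabels : ∀ a {z} → z ∈ domain a → to (πₐ a) z ≡ relabelₐ a z
  πₐ-relabels a = proj₂ (extend-injection (λ _ _ → em) (domain a) (relabelₐ a) (relabelₐ-injective a))

  πₐ-fixes-P : ∀ a → πₐ a Fixes P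
  πₐ-fixes-P a {z} z∈P = trans (πₐ-relabels a z∈domain) (stays (relabelₐ-kind a z∈domain))
    where
    z∈domain : z ∈ domain a
    z∈domain = ∈-++⁺ˡ z∈P
    stays : ∀ {w} → Kind (canonical a) a (avoidingBlock a) z w → w ≡ z
    stays (fixed _) = refl
    stays (entry j cj≡z) = trans (sym (canonical-∈P a j (subst (_∈ P) (sym cj≡z) z∈P))) cj≡z
    stays (spare _ _ z∉P _) = ⊥-elim (z∉P z∈P)

  πₐ-canonical : ∀ a → map (to (πₐ a)) (canonical a) ≡ a
  πₐ-canonical a = begin
    map (to (πₐ a)) (canonical a)                      ≡⟨ cong (map (to (πₐ a))) (tabulate∘lookup (canonical a)) ⟨
    map (to (πₐ a)) (tabulate (lookup (canonical a)))  ≡⟨ tabulate-∘ (to (πₐ a)) (lookup (canonical a)) ⟨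
    tabulate (to (πₐ a) ∘ lookup (canonical a))        ≡⟨ tabulate-cong moves ⟩
    tabulate (lookup a)                                ≡⟨ tabulate∘lookup a ⟩
    a                                                  ∎
    where
    open ≡-Reasoning
    cj∈domain : ∀ j → lookup (canonical a) j ∈ domain a
    cj∈domain j = ∈-++⁺ʳ P (∈-++⁺ˡ (∈-toList⁺ (∈-lookupᵥ j (canonical a))))
    lands : ∀ j {w} → Kind (canonical a) a (avoidingBlock a) (lookup (canonical a) j) w → w ≡ lookup a j
    lands j (fixed cj∈P) = canonical-∈P a j cj∈P
    lands j (entry j' cj'≡cj) = canonical-injective a cj'≡cj
    lands j (spare _ _ _ ¬entry) = ⊥-elim (¬entry j refl)
    moves : ∀ j → to (πₐ a) (lookup (canonical a) j) ≡ lookup a j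
    moves j = trans (πₐ-relabels a (cj∈domain j)) (lands j (relabelₐ-kind a (cj∈domain j)))

  πₐ-act : ∀ ρ → ρ Fixes Q → ∀ a {z} → z ∈ supportOf (δ₀ (canonical a)) →
           to (πₐ (map (to ρ) a)) z ≡ to ρ (to (πₐ a) z)
  πₐ-act ρ fixes a {z} z∈supp = begin
    to (πₐ ρa) z
      ≡⟨ πₐ-relabels ρa (∈-++⁺ʳ P (∈-++⁺ʳ _ (subst (λ v → z ∈ supportOf (δ₀ v)) (sym same-canonical) z∈supp))) ⟩
    relabel (canonical ρa) ρa (avoidingBlock ρa) z em em em
      ≡⟨ cong₂ (λ v i → relabel v ρa i z em em em) same-canonical (avoidingBlock-act ρ fixes a) ⟩
    relabel (canonical a) ρa (avoidingBlock a) z em em em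
      ≡⟨ relabel-act ρ fixes _ a _ z em em em (support⊆E a z∈supp) ⟩
    to ρ (relabelₐ a z)
      ≡⟨ cong (to ρ) (πₐ-relabels a (∈-++⁺ʳ P (∈-++⁺ʳ _ z∈supp))) ⟨
    to ρ (to (πₐ a) z) ∎
    where
    open ≡-Reasoning
    ρa : Vec I N
    ρa = map (to ρ) a
    same-canonical : canonical ρa ≡ canonical a
    same-canonical = canonical-act ρ (fixes ∘ ∈-++⁺ˡ) a

  choose : Vec I N → JPred k
  choose a = πₐ a · δ₀ (canonical a)

  choose-R : ∀ a → R a (choose a)
  choose-R a = subst (λ b → R b (choose a)) (πₐ-canonical a)
    (R-invariant (πₐ a) (πₐ-fixes-P a) (canonical a) (δ₀ (canonical a)) (proj₂ (R-total (canonical a))))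

  Equivariant : List I → (Vec I N → JPred k) → Set
  Equivariant Q F = ∀ ρ → ρ Fixes Q → ∀ a b → proj₁ (F (map (to ρ) a)) (map (to ρ) b) ≡ proj₁ (F a) b

  choose-equivariant : Equivariant Q choose
  choose-equivariant ρ fixes a b = begin
    proj₁ (δ₀ (canonical ρa)) (map (from (πₐ ρa)) (map (to ρ) b))
      ≡⟨ cong (λ c → proj₁ (δ₀ c) (map (from (πₐ ρa)) (map (to ρ) b))) (canonical-act ρ (fixes ∘ ∈-++⁺ˡ) a) ⟩
    (proj₁ δ ^ πₐ ρa) (map (to ρ) b)
      ≡⟨ ^-resp-support (proj₂ (proj₂ δ)) (πₐ ρa) (ρ ↔-∘ πₐ a) (πₐ-act ρ fixes a) (map (to ρ) b) ⟩
    proj₁ δ (map (from (πₐ a) ∘ from ρ) (map (to ρ) b))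
      ≡⟨ cong (proj₁ δ) (map-∘ (from (πₐ a)) (from ρ) _) ⟩
    proj₁ δ (map (from (πₐ a)) (map (from ρ) (map (to ρ) b)))
      ≡⟨ cong (proj₁ δ ∘ map (from (πₐ a))) (map-from-to ρ b) ⟩
    proj₁ δ (map (from (πₐ a)) b) ∎
    where
    open ≡-Reasoning
    ρa : Vec I N
    ρa = map (to ρ) a
    δ : JPred k
    δ = δ₀ (canonical a)

  uniformization : Σ (Vec I N → JPred k) λ F → (∀ a → R a (F a)) × Σ (List I) λ Q → Equivariant Q F
  uniformization = choose , choose-R , Q , choose-equivariant

module ChoiceWitness
  (em : ExcludedMiddle 0ℓ) (I : Set) (infinite : Infinite I)
  (n' m' : ℕ) (xs : Vec ℕ (suc n')) (ys : Vec ℕ (suc m')) (D S : ℕ) (H : Formula)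
  (σ : Semantics.Assignment I (J₀-model I))
  (premise : Semantics.⟦_⟧ I (J₀-model I) (∀ᵢs xs (∃ₚ m' D H)) σ)
  where
  open Semantics I (J₀-model I)
  open Coincidence {I} {J₀-model I}
  open Invariance I

  Chosen : Vec I (suc n') → JPred m' → Set
  Chosen as δ = ⟦ H ⟧ (updPred (σ ⟨ xs ≔ as ⟩) m' D δ)

  Chosen-invariant : ∀ π → π Fixes support H σ → ∀ as δ → Chosen as δ → Chosen (map (to π) as) (π · δ)
  Chosen-invariant π fixes as δ h = ⟦⟧-agree H (Agree-trans (act-updPred π _ m' D δ) moved) (⟦⟧-act H π _ h)
    where
    moved : AgreeOn H (updPred (act π (σ ⟨ xs ≔ as ⟩)) m' D (π · δ))
                      (updPred (σ ⟨ xs ≔ map (to π) as ⟩) m' D (π · δ))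
    moved = updPred-agree m' D
      (Agree-trans (act-updInds π σ xs as) (updInds-agree xs (map (to π) as) (act-fixing-support H π σ fixes)))
      (λ _ → refl)

  open Uniformization em infinite (support H σ) Chosen Chosen-invariant (∀ᵢs-elim xs (∃ₚ m' D H) σ premise)
    using (uniformization; Equivariant)

  -- Keeps the conversion checker from unfolding the construction of choose.
  abstract
    choose : Vec I (suc n') → JPred m'
    choose = proj₁ uniformization

    choose-Chosen : ∀ as → Chosen as (choose as)
    choose-Chosen = proj₁ (proj₂ uniformization)

    Q : List I
    Q = proj₁ (proj₂ (proj₂ uniformization))

    choose-equivariant : Equivariant Q choose
    choose-equivariant = proj₂ (proj₂ (proj₂ uniformization))

  S-witness : JPred (n' + suc m')
  S-witness = chosen , Q , Q-supports
    where
    chosen : Pred I (suc n' + suc m')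
    chosen v = proj₁ (choose (take (suc n') v)) (drop (suc n') v)
    Q-supports : Q Supports chosen
    Q-supports ρ fixes v = trans
      (cong₂ (λ a b → proj₁ (choose a) b) (take-map (from ρ) (suc n') v) (drop-map (from ρ) (suc n') v))
      (choose-equivariant (↔-sym ρ) (↔-sym-fixes {π = ρ} fixes) (take (suc n') v) (drop (suc n') v))

  σ₁ : Assignment
  σ₁ = updPred σ (n' + suc m') S S-witness

  H-holds : (n' + suc m' , S) ∉ predVars H → ∀ as → ⟦ H ⟧ (updPred (σ₁ ⟨ xs ≔ as ⟩) m' D (choose as))
  H-holds S∉H as = ⟦⟧-agree H
    (updPred-agree m' D (updInds-agree xs as (updPred-fresh σ _ S S-witness S∉H)) (λ _ → refl))
    (choose-Chosen as)

  S-defines-D : Distinct xs → Distinct ys → DisjointV xs ys → ∀ as bs →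
                ⟦ iff (app m' D ys) (app (n' + suc m') S (xs ++ ys)) ⟧
                  (updPred (σ₁ ⟨ xs ≔ as ⟩) m' D (choose as) ⟨ ys ≔ bs ⟩)
  S-defines-D xs-distinct ys-distinct xs#ys as bs =
    (λ Dys → trans S-value (trans (sym D-value) Dys)) , (λ Sxsys → trans D-value (trans (sym S-value) Sxsys))
    where
    τ : Assignment
    τ = updPred (σ₁ ⟨ xs ≔ as ⟩) m' D (choose as) ⟨ ys ≔ bs ⟩

    D-value : proj₁ (prd τ m' D) (map (ind τ) ys) ≡ proj₁ (choose as) bs
    D-value = cong₂ (λ δ w → proj₁ δ w) (updInds-updPred-same _ ys bs m' D (choose as))
                                          (updInds-lookup _ ys bs ys-distinct)

    xs∉ys : ∀ {x} → x ∈ toList xs → x ∉ toList ys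
    xs∉ys x∈xs x∈ys = xs#ys (proj₁ (∈-toList⇒lookup x∈xs)) (proj₁ (∈-toList⇒lookup x∈ys))
      (trans (proj₂ (∈-toList⇒lookup x∈xs)) (sym (proj₂ (∈-toList⇒lookup x∈ys))))

    arguments : map (ind τ) (xs ++ ys) ≡ as ++ bs
    arguments = begin
      map (ind τ) (xs ++ ys)             ≡⟨ map-++ (ind τ) xs ys ⟩
      map (ind τ) xs ++ map (ind τ) ys   ≡⟨ cong₂ _++_ (map-cong-on xs (updInds-other _ ys bs ∘ xs∉ys))
                                                       (updInds-lookup _ ys bs ys-distinct) ⟩
      map (ind (σ₁ ⟨ xs ≔ as ⟩)) xs ++ bs ≡⟨ cong (_++ bs) (updInds-lookup σ₁ xs as xs-distinct) ⟩
      as ++ bs                           ∎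
      where open ≡-Reasoning

    arities-differ : m' ≢ n' + suc m'
    arities-differ e = <-irrefl e (m≤n+m (suc m') n')

    S-is-witness : prd τ (n' + suc m') S ≡ S-witness
    S-is-witness = trans (updInds-updPred-other (σ₁ ⟨ xs ≔ as ⟩) ys bs (choose as) (arities-differ ∘ proj₁))
                         (updInds-updPred-same σ xs as (n' + suc m') S S-witness)

    S-value : proj₁ (prd τ (n' + suc m') S) (map (ind τ) (xs ++ ys)) ≡ proj₁ (choose as) bs
    S-value = trans (cong₂ (λ δ w → proj₁ δ w) S-is-witness arguments)
                    (cong₂ (λ a b → proj₁ (choose a) b) (take-++ as bs) (drop-++ as bs))

proposition4p14 : ExcludedMiddle 0ℓ → (I : Set) → Infinite I →
    (n' m' : ℕ) (xs : Vec ℕ (suc n')) (ys : Vec ℕ (suc m')) (D S : ℕ) (H : Formula) →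
    Distinct xs → Distinct ys → DisjointV xs ys →
    ((j : Fin (suc m')) → lookup ys j ∉ indVars H) →
    (n' + suc m' , S) ∉ predVars H →
    I ⊨Σ₀ choice n' m' xs ys D S H
proposition4p14 em I infinite n' m' xs ys D S H xs-distinct ys-distinct xs#ys _ S∉H σ premise =
  S-witness , ∀ᵢs-intro xs _ σ₁ λ as →
    choose as , ∀ᵢs-intro ys _ _ (S-defines-D xs-distinct ys-distinct xs#ys as) , H-holds S∉H as
  where
  open ChoiceWitness em I infinite n' m' xs ys D S H σ premise
  open Coincidence {I} {J₀-model I} using (∀ᵢs-intro)
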